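{- Let $d\ge 0$, let $\mathcal{H}=(V,H)$ be a paving simplicial complex of dimension $d$, and let $m\ge 0$. Then $$H^{(m)} = P_{\le d+m+1}(V)\setminus\{X\in P_{d+m+1}(V) \mid P_{d+1}(X)\cap H=\emptyset\}.$$
   Context: A simplicial complex is a pair $(V,H)$ with $V$ finite nonempty, $H\subseteq 2^V$ containing all singletons and closed under subsets; its dimension is $\max\{|X|:X\in H\}-1$. $P_k(V)$ (resp. $P_{\le k}(V)$) denotes the set of subsets of $V$ with exactly (resp. at most) $k$ elements. A complex of dimension $d$ is paving if $P_{\le d}(V)\subseteq H$. The up operator is $H^{\mathrm{up}} = H\cup\{I\cup\{p\} : I\in H,\ p\in V\setminus I\}$, and $H^{(m)}$ denotes the result of applying the up operator $m$ times to $H$ (with $H^{(0)}=H$). -}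

module Defs where

open import Level using (0ℓ)
open import Data.Nat using (ℕ; zero; suc; _+_; _≤_)
open import Data.Fin using (Fin)
open import Data.Fin.Subset using (Subset; _∈_; _∉_; _⊆_; _∪_; ⁅_⁆; ∣_∣)
open import Data.Product using (Σ; _×_; ∃)
open import Data.Sum using (_⊎_)
open import Data.Empty using (⊥)
open import Relation.Nullary using (¬_)
open import Relation.Binary.PropositionalEquality using (_≡_)

Family : ℕ → Set₁
Family n = Subset n → Set

record IsSimplicialComplex {n : ℕ} (H : Family n) : Set where
  field
    singletons : ∀ (v : Fin n) → H ⁅ v ⁆
    downClosed : ∀ {X Y : Subset n} → H X → Y ⊆ X → H Y

-- dimension d: max{|X| : X ∈ H} - 1 = d
HasDimension : ∀ {n : ℕ} → Family n → ℕ → Set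
HasDimension {n} H d =
  (Σ (Subset n) λ X → H X × ∣ X ∣ ≡ suc d)
  × (∀ (X : Subset n) → H X → ∣ X ∣ ≤ suc d)

IsPaving : ∀ {n : ℕ} → Family n → ℕ → Set
IsPaving {n} H d = ∀ (X : Subset n) → ∣ X ∣ ≤ d → H X

up : ∀ {n : ℕ} → Family n → Family n
up {n} H X = H X ⊎ (Σ (Subset n) λ I → Σ (Fin n) λ p → H I × p ∉ I × X ≡ I ∪ ⁅ p ⁆)

upIter : ∀ {n : ℕ} → ℕ → Family n → Family n
upIter zero    H = H
upIter (suc m) H = up (upIter m H)

RHS : ∀ {n : ℕ} → Family n → ℕ → ℕ → Family n
RHS {n} H d m X =
  ∣ X ∣ ≤ d + m + 1
  × ¬ (∣ X ∣ ≡ d + m + 1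
       × (∀ (Y : Subset n) → Y ⊆ X → ∣ Y ∣ ≡ d + 1 → ¬ H Y))

{-# OPTIONS --safe #-}
-- Induction on m, through the positive description of H^(m) as the sets of
-- size < d+m+1 together with the (d+m+1)-sets containing a d-face. One up step
-- raises the bound by one: a set of size < d+m+2 is obtained by adding any of
-- its points to a strictly smaller set, and a (d+m+2)-set containing a d-face Y
-- by adding a point outside Y to a (d+m+1)-set that still contains Y. Since the
-- faces of H are decidable and there are finitely many subsets, the positive
-- description agrees with the negative one in the statement.
module Submission where

open import Defs
open import Data.Nat using (ℕ; zero; suc; _+_; _≤_; _<_; z≤n; s≤s; s≤s⁻¹)
open import Data.Nat.Properties
  using (+-comm; ≤-refl; n≤1+n; ≤-reflexive; ≤-trans; <⇒≤; ≤-<-trans; <-irrefl; <⇒≱; m≤n+m; m≤n⇒m<n∨m≡n; _≟_)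
open import Data.Fin as Fin using (Fin; zero; suc)
open import Data.Fin.Subset using (Subset; inside; outside; _∈_; _∉_; _⊆_; _∪_; _─_; _-_; ⁅_⁆; ∣_∣; ⊥; Nonempty)
open import Data.Fin.Subset.Properties
  using (_∈?_; _⊆?_; nonempty?; anySubset?; ∣⊥∣≡0; x∈⁅x⁆; x∈⁅y⁆⇒x≡y; x∈p∪q⁻; p⊆p∪q; q⊆p∪q; ∪-identityʳ;
         p─q⊆p; x∈p∧x∉q⇒x∈p─q; x∈p∧x≢y⇒x∈p-y; x∈p⇒∣p-x∣<∣p∣; ⊆-refl; ⊆-antisym; p⊆q⇒∣p∣≤∣q∣; p⊂q⇒∣p∣<∣q∣)
open import Data.Vec using (_∷_; here; there)
open import Data.Product using (Σ; ∃; _×_; _,_)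
open import Data.Sum using (_⊎_; inj₁; inj₂)
open import Function using (_∘_)
open import Function.Bundles using (_⇔_; mk⇔; Equivalence)
open import Function.Construct.Composition using (_⇔-∘_)
open import Relation.Nullary using (¬_; yes; no; contradiction)
open import Relation.Nullary.Decidable using (decidable-stable; _×-dec_)
open import Relation.Unary using (Decidable)
open import Relation.Binary.PropositionalEquality using (_≡_; refl; sym; trans; subst; subst₂)

private
  variable
    k : ℕ
    x : Fin k
    p q : Subset k

x∈p─q⇒x∉q : x ∈ p ─ q → x ∉ q
x∈p─q⇒x∉q {p = inside ∷ _} {q = outside ∷ _} here ()
x∈p─q⇒x∉q {p = _ ∷ _}      {q = _ ∷ _}       (there x∈p─q) (there x∈q) = x∈p─q⇒x∉q x∈p─q x∈q

x∉p-x : ∀ (p : Subset k) x → x ∉ p - x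
x∉p-x p x x∈p-x = x∈p─q⇒x∉q x∈p-x (x∈⁅x⁆ x)

p-x∪⁅x⁆≡p : x ∈ p → (p - x) ∪ ⁅ x ⁆ ≡ p
p-x∪⁅x⁆≡p {x = x} {p = p} x∈p = ⊆-antisym ⊆p p⊆
  where
  ⊆p : (p - x) ∪ ⁅ x ⁆ ⊆ p
  ⊆p y∈ with x∈p∪q⁻ (p - x) ⁅ x ⁆ y∈
  ... | inj₁ y∈p-x = p─q⊆p p ⁅ x ⁆ y∈p-x
  ... | inj₂ y∈⁅x⁆ = subst (_∈ p) (sym (x∈⁅y⁆⇒x≡y x y∈⁅x⁆)) x∈p
  p⊆ : p ⊆ (p - x) ∪ ⁅ x ⁆
  p⊆ {y} y∈p with y Fin.≟ x
  ... | yes refl = q⊆p∪q (p - x) ⁅ x ⁆ (x∈⁅x⁆ x)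
  ... | no y≢x   = p⊆p∪q ⁅ x ⁆ (x∈p∧x≢y⇒x∈p-y y∈p y≢x)

∣p∪⁅x⁆∣≤1+∣p∣ : ∀ (p : Subset k) x → ∣ p ∪ ⁅ x ⁆ ∣ ≤ suc ∣ p ∣
∣p∪⁅x⁆∣≤1+∣p∣ (inside ∷ p)  zero    rewrite ∪-identityʳ p = s≤s (n≤1+n _)
∣p∪⁅x⁆∣≤1+∣p∣ (outside ∷ p) zero    rewrite ∪-identityʳ p = ≤-refl
∣p∪⁅x⁆∣≤1+∣p∣ (inside ∷ p)  (suc x) = s≤s (∣p∪⁅x⁆∣≤1+∣p∣ p x)
∣p∪⁅x⁆∣≤1+∣p∣ (outside ∷ p) (suc x) = ∣p∪⁅x⁆∣≤1+∣p∣ p x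

⊆⊎∃∉ : ∀ (p q : Subset k) → p ⊆ q ⊎ ∃ λ x → x ∈ p × x ∉ q
⊆⊎∃∉ p q with nonempty? (p ─ q)
... | yes (x , x∈p─q) = inj₂ (x , p─q⊆p p q x∈p─q , x∈p─q⇒x∉q x∈p─q)
... | no  p─q-empty   = inj₁ λ {x} x∈p →
  decidable-stable (x ∈? q) (λ x∉q → p─q-empty (x , x∈p∧x∉q⇒x∈p─q x∈p x∉q))

∣q∣<∣p∣⇒∃∉ : ∣ q ∣ < ∣ p ∣ → ∃ λ x → x ∈ p × x ∉ q
∣q∣<∣p∣⇒∃∉ {q = q} {p = p} ∣q∣<∣p∣ with ⊆⊎∃∉ p q
... | inj₁ p⊆q = contradiction (p⊆q⇒∣p∣≤∣q∣ p⊆q) (<⇒≱ ∣q∣<∣p∣)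
... | inj₂ witness = witness

0<∣p∣⇒Nonempty : 0 < ∣ p ∣ → Nonempty p
0<∣p∣⇒Nonempty {k} {p} 0<∣p∣ with ∣q∣<∣p∣⇒∃∉ {q = ⊥} (subst (_< ∣ p ∣) (sym (∣⊥∣≡0 k)) 0<∣p∣)
... | x , x∈p , _ = x , x∈p

p⊆q∧∣q∣≤∣p∣⇒p≡q : p ⊆ q → ∣ q ∣ ≤ ∣ p ∣ → p ≡ q
p⊆q∧∣q∣≤∣p∣⇒p≡q {p = p} {q = q} p⊆q ∣q∣≤∣p∣ with ⊆⊎∃∉ q p
... | inj₁ q⊆p = ⊆-antisym p⊆q q⊆p
... | inj₂ (x , x∈q , x∉p) = contradiction ∣q∣≤∣p∣ (<⇒≱ (p⊂q⇒∣p∣<∣q∣ (p⊆q , x , x∈q , x∉p)))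

ContainsFace : Family k → ℕ → Subset k → Set
ContainsFace {k} K t X = Σ (Subset k) λ Y → Y ⊆ X × ∣ Y ∣ ≡ t × K Y

Saturation : Family k → ℕ → ℕ → Family k
Saturation K t b X = ∣ X ∣ < b ⊎ (∣ X ∣ ≡ b × ContainsFace K t X)

saturation⇒∣∣≤ : ∀ {K : Family k} {t b X} → Saturation K t b X → ∣ X ∣ ≤ b
saturation⇒∣∣≤ (inj₁ ∣X∣<b)       = <⇒≤ ∣X∣<b
saturation⇒∣∣≤ (inj₂ (∣X∣≡b , _)) = ≤-reflexive ∣X∣≡b

saturation⁺ : ∀ {K : Family k} {t b X} → ∣ X ∣ ≤ b → ContainsFace K t X → Saturation K t b X
saturation⁺ ∣X∣≤b face with m≤n⇒m<n∨m≡n ∣X∣≤b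
... | inj₁ ∣X∣<b = inj₁ ∣X∣<b
... | inj₂ ∣X∣≡b = inj₂ (∣X∣≡b , face)

up-by-removal : ∀ {G : Family k} {X x} → x ∈ X → G (X - x) → up G X
up-by-removal {X = X} {x} x∈X G[X-x] = inj₂ (X - x , x , G[X-x] , x∉p-x X x , sym (p-x∪⁅x⁆≡p x∈X))

up-saturation : ∀ {G K : Family k} {d b} → suc d ≤ b
  → (∀ X → G X ⇔ Saturation K (suc d) b X)
  → ∀ X → up G X ⇔ Saturation K (suc d) (suc b) X
up-saturation {G = G} {K} {d} {b} d<b G⇔ X = mk⇔ to from
  where
  to : up G X → Saturation K (suc d) (suc b) X
  to (inj₁ GX) = inj₁ (s≤s (saturation⇒∣∣≤ (Equivalence.to (G⇔ X) GX)))
  to (inj₂ (I , x , GI , _ , refl)) with Equivalence.to (G⇔ I) GI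
  ... | inj₁ ∣I∣<b = inj₁ (≤-<-trans (∣p∪⁅x⁆∣≤1+∣p∣ I x) (s≤s ∣I∣<b))
  ... | inj₂ (∣I∣≡b , Y , Y⊆I , face) =
    saturation⁺ (≤-trans (∣p∪⁅x⁆∣≤1+∣p∣ I x) (s≤s (≤-reflexive ∣I∣≡b))) (Y , p⊆p∪q ⁅ x ⁆ ∘ Y⊆I , face)

  from : Saturation K (suc d) (suc b) X → up G X
  from (inj₁ ∣X∣<1+b) with m≤n⇒m<n∨m≡n (s≤s⁻¹ ∣X∣<1+b)
  ... | inj₁ ∣X∣<b = inj₁ (Equivalence.from (G⇔ X) (inj₁ ∣X∣<b))
  ... | inj₂ ∣X∣≡b with 0<∣p∣⇒Nonempty (subst (0 <_) (sym ∣X∣≡b) (≤-trans (s≤s z≤n) d<b))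
  ...   | x , x∈X = up-by-removal x∈X (Equivalence.from (G⇔ (X - x)) (inj₁ ∣X-x∣<b))
    where
    ∣X-x∣<b : ∣ X - x ∣ < b
    ∣X-x∣<b = subst (∣ X - x ∣ <_) ∣X∣≡b (x∈p⇒∣p-x∣<∣p∣ x∈X)
  from (inj₂ (∣X∣≡1+b , Y , Y⊆X , ∣Y∣≡1+d , KY))
    with ∣q∣<∣p∣⇒∃∉ (subst₂ _<_ (sym ∣Y∣≡1+d) (sym ∣X∣≡1+b) (s≤s d<b))
  ... | x , x∈X , x∉Y =
    up-by-removal x∈X (Equivalence.from (G⇔ (X - x)) (saturation⁺ ∣X-x∣≤b (Y , Y⊆X-x , ∣Y∣≡1+d , KY)))
    where
    ∣X-x∣≤b : ∣ X - x ∣ ≤ b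
    ∣X-x∣≤b = s≤s⁻¹ (subst (∣ X - x ∣ <_) ∣X∣≡1+b (x∈p⇒∣p-x∣<∣p∣ x∈X))
    Y⊆X-x : Y ⊆ X - x
    Y⊆X-x y∈Y = x∈p∧x≢y⇒x∈p-y (Y⊆X y∈Y) (λ { refl → x∉Y y∈Y })

upIter-saturation : ∀ {G K : Family k} {d b} → suc d ≤ b
  → (∀ X → G X ⇔ Saturation K (suc d) b X)
  → ∀ m X → upIter m G X ⇔ Saturation K (suc d) (m + b) X
upIter-saturation d<b G⇔ zero    = G⇔
upIter-saturation {b = b} d<b G⇔ (suc m) =
  up-saturation (≤-trans d<b (m≤n+m b m)) (upIter-saturation d<b G⇔ m)

paving⇒⇔saturation : ∀ {H : Family k} {b}
  → (∀ X → H X → ∣ X ∣ ≤ b) → (∀ X → ∣ X ∣ < b → H X)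
  → ∀ X → H X ⇔ Saturation H b b X
paving⇒⇔saturation {H = H} {b} bounded paving X = mk⇔ to from
  where
  to : H X → Saturation H b b X
  to HX with m≤n⇒m<n∨m≡n (bounded X HX)
  ... | inj₁ ∣X∣<b = inj₁ ∣X∣<b
  ... | inj₂ ∣X∣≡b = inj₂ (∣X∣≡b , X , ⊆-refl , ∣X∣≡b , HX)
  from : Saturation H b b X → H X
  from (inj₁ ∣X∣<b) = paving X ∣X∣<b
  from (inj₂ (∣X∣≡b , Y , Y⊆X , ∣Y∣≡b , HY)) =
    subst H (p⊆q∧∣q∣≤∣p∣⇒p≡q Y⊆X (≤-reflexive (trans ∣X∣≡b (sym ∣Y∣≡b)))) HY

containsFace? : ∀ {K : Family k} {t} → Decidable K → Decidable (ContainsFace K t)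
containsFace? {t = t} K? X = anySubset? λ Y → (Y ⊆? X) ×-dec (∣ Y ∣ ≟ t) ×-dec K? Y

saturation⇔≤∧¬faceless : ∀ {K : Family k} {t b X} → Decidable K
  → Saturation K t b X ⇔ (∣ X ∣ ≤ b × ¬ (∣ X ∣ ≡ b × (∀ Y → Y ⊆ X → ∣ Y ∣ ≡ t → ¬ K Y)))
saturation⇔≤∧¬faceless {K = K} {t} {b} {X} K? = mk⇔ to from
  where
  to : Saturation K t b X → ∣ X ∣ ≤ b × ¬ (∣ X ∣ ≡ b × (∀ Y → Y ⊆ X → ∣ Y ∣ ≡ t → ¬ K Y))
  to (inj₁ ∣X∣<b) = <⇒≤ ∣X∣<b , λ (∣X∣≡b , _) → <-irrefl ∣X∣≡b ∣X∣<b
  to (inj₂ (∣X∣≡b , Y , Y⊆X , ∣Y∣≡t , KY)) = ≤-reflexive ∣X∣≡b , λ (_ , faceless) → faceless Y Y⊆X ∣Y∣≡t KY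
  from : ∣ X ∣ ≤ b × ¬ (∣ X ∣ ≡ b × (∀ Y → Y ⊆ X → ∣ Y ∣ ≡ t → ¬ K Y)) → Saturation K t b X
  from (∣X∣≤b , ¬faceless) with m≤n⇒m<n∨m≡n ∣X∣≤b
  ... | inj₁ ∣X∣<b = inj₁ ∣X∣<b
  ... | inj₂ ∣X∣≡b = inj₂ (∣X∣≡b , decidable-stable (containsFace? K? X) λ noFace →
    ¬faceless (∣X∣≡b , λ Y Y⊆X ∣Y∣≡t KY → noFace (Y , Y⊆X , ∣Y∣≡t , KY)))

theorem3p7 : ∀ (n d : ℕ) (H : Family (suc n)) → Decidable H
    → IsSimplicialComplex H → HasDimension H d → IsPaving H d
    → ∀ (m : ℕ) (X : Subset (suc n)) → (upIter m H X ⇔ RHS H d m X)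
theorem3p7 _ d H H? _ (_ , dim≤) paving m X =
  saturation⇔≤∧¬faceless H? ⇔-∘ subst₂ (λ t b → upIter m H X ⇔ Saturation H t b X)
    (+-comm 1 d) (trans (+-comm m (suc d)) (+-comm 1 (d + m))) (upIter-saturation ≤-refl H⇔ m X)
  where
  H⇔ : ∀ X → H X ⇔ Saturation H (suc d) (suc d) X
  H⇔ = paving⇒⇔saturation dim≤ (λ X → paving X ∘ s≤s⁻¹)
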